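{- Let $H$ be any graph, $P$ any path and $c\in\mathbb{N}$. If $G$ is any $n$-vertex graph contained in $H\boxtimes P\boxtimes K_c$, then $G$ is contained in $L\boxtimes K_m$ for some graph $L$ with $\mathrm{tw}(L)\le\mathrm{tw}(H)+1$ and some integer $m\le\sqrt{cn}$.
   Context: $\mathrm{tw}$ denotes tree-width. The strong product $A\boxtimes B$ has vertex set $V(A)\times V(B)$, with distinct $(v,x),(w,y)$ adjacent iff ($v=w$ and $xy\in E(B)$) or ($x=y$ and $vw\in E(A)$) or ($vw\in E(A)$ and $xy\in E(B)$); it is associative up to isomorphism. Contained means isomorphic to a subgraph. -}

module Defs where

open import Data.Nat using (ℕ; zero; suc; _*_; _≤_)
open import Data.Fin using (Fin; toℕ)
open import Data.Fin.Properties using (*↔×)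
open import Data.Product using (Σ; ∃; ∃-syntax; _×_; _,_; proj₁; proj₂)
open import Data.Sum using (_⊎_; inj₁; inj₂)
open import Data.Empty using (⊥)
open import Data.Unit using (⊤)
open import Data.List using (List; []; _∷_; length)
open import Data.List.Membership.Propositional using (_∈_)
open import Data.List.Relation.Unary.Unique.Propositional using (Unique)
open import Relation.Nullary using (¬_)
open import Relation.Binary.PropositionalEquality using (_≡_; refl)
open import Function using (_↔_)
open import Function.Definitions using (Injective)
open import Function.Properties.Inverse using (↔-trans)
open import Data.Product.Function.NonDependent.Propositional using (_×-↔_)

record Graph : Set₁ where
  field
    V     : Set
    size  : ℕ
    enum  : Fin size ↔ V
    E     : V → V → Set
    Esym   : ∀ {x y} → E x y → E y x
    Eirrefl : ∀ {x} → ¬ E x x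
open Graph public

∣_∣ᵥ : Graph → ℕ
∣ G ∣ᵥ = size G

data SE (A B : Graph) : V A × V B → V A × V B → Set where
  sameA : ∀ {v x y} → E B x y → SE A B (v , x) (v , y)
  sameB : ∀ {v w x} → E A v w → SE A B (v , x) (w , x)
  both  : ∀ {v w x y} → E A v w → E B x y → SE A B (v , x) (w , y)

SE-sym : ∀ {A B p q} → SE A B p q → SE A B q p
SE-sym {A} {B} (sameA e) = sameA (Esym B e)
SE-sym {A} {B} (sameB e) = sameB (Esym A e)
SE-sym {A} {B} (both e f) = both (Esym A e) (Esym B f)

SE-irrefl : ∀ {A B p} → ¬ SE A B p p
SE-irrefl {A} {B} (sameA e) = Eirrefl B e
SE-irrefl {A} {B} (sameB e) = Eirrefl A e
SE-irrefl {A} {B} (both e f) = Eirrefl A e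

_⊠_ : Graph → Graph → Graph
A ⊠ B = record
  { V = V A × V B
  ; size = size A * size B
  ; enum = ↔-trans *↔× (enum A ×-↔ enum B)
  ; E = SE A B
  ; Esym = SE-sym
  ; Eirrefl = SE-irrefl
  }
infixl 7 _⊠_

data KE {c : ℕ} (i j : Fin c) : Set where
  kedge : ¬ i ≡ j → KE i j

K : ℕ → Graph
K c = record
  { V = Fin c ; size = c ; enum = Function.Properties.Inverse.↔-refl
  ; E = KE ; Esym = λ { (kedge p) → kedge (λ q → p (Relation.Binary.PropositionalEquality.sym q)) }
  ; Eirrefl = λ { (kedge p) → p refl } }
  where import Function.Properties.Inverse
        import Relation.Binary.PropositionalEquality

data PE {k : ℕ} (i j : Fin k) : Set where
  fwd : toℕ j ≡ suc (toℕ i) → PE i j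
  bwd : toℕ i ≡ suc (toℕ j) → PE i j

PE-irrefl : ∀ {k} {i : Fin k} → ¬ PE i i
PE-irrefl {i = i} (fwd p) = noFix (toℕ i) p
  where noFix : ∀ n → ¬ n ≡ suc n
        noFix zero ()
        noFix (suc n) q = noFix n (Data.Nat.Properties.suc-injective q)
          where import Data.Nat.Properties
PE-irrefl {i = i} (bwd p) = noFix (toℕ i) p
  where noFix : ∀ n → ¬ n ≡ suc n
        noFix zero ()
        noFix (suc n) q = noFix n (Data.Nat.Properties.suc-injective q)
          where import Data.Nat.Properties

PathG : ℕ → Graph
PathG k = record
  { V = Fin k ; size = k ; enum = Function.Properties.Inverse.↔-refl
  ; E = PE
  ; Esym = λ { (fwd p) → bwd p ; (bwd p) → fwd p }
  ; Eirrefl = PE-irrefl }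
  where import Function.Properties.Inverse

_⊆G_ : Graph → Graph → Set
G ⊆G H = Σ (V G → V H) λ f → Injective _≡_ _≡_ f × (∀ {x y} → E G x y → E H (f x) (f y))

data Walk (G : Graph) (P : V G → Set) : V G → V G → Set where
  here : ∀ {x} → P x → Walk G P x x
  step : ∀ {x y z} → P x → E G x y → Walk G P y z → Walk G P x z

Connected : Graph → Set
Connected G = ∀ x y → Walk G (λ _ → ⊤) x y

-- A cycle: a duplicate-free list of at least three vertices
-- v₀ v₁ … v_k with consecutive vertices adjacent and v_k adjacent to v₀.
data PathFrom (G : Graph) : V G → List (V G) → V G → Set where
  end  : ∀ {x} → PathFrom G x [] x
  cons : ∀ {x y z vs} → E G x y → PathFrom G y vs z → PathFrom G x (y ∷ vs) z

record Cycle (G : Graph) : Set where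
  field
    start  : V G
    rest   : List (V G)
    last   : V G
    long   : 2 ≤ length rest
    walk   : PathFrom G start rest last
    close  : E G last start
    distinct : Unique (start ∷ rest)

-- A tree: nonempty, connected, acyclic finite graph.
IsTree : Graph → Set
IsTree T = V T × Connected T × ¬ Cycle T

record TreeDecomposition (G : Graph) : Set₁ where
  field
    T       : Graph
    isTree  : IsTree T
    bag     : V T → List (V G)
    vcover  : ∀ v → ∃[ t ] v ∈ bag t
    ecover  : ∀ {v w} → E G v w → ∃[ t ] (v ∈ bag t × w ∈ bag t)
    subtree : ∀ v s t → v ∈ bag s → v ∈ bag t → Walk T (λ u → v ∈ bag u) s t
open TreeDecomposition public

TwLe : Graph → ℕ → Set₁
TwLe G k = Σ (TreeDecomposition G) λ D → ∀ t → length (bag D t) ≤ suc k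

-- tw(L) ≤ tw(H) + 1, unfolded: every width bound for H, increased by one,
-- is a width bound for L (tw is the minimal such width).
TwLeTwPlusOne : Graph → Graph → Set₁
TwLeTwPlusOne L H = ∀ k → TwLe H k → TwLe L (suc k)

-- Let d be largest with c·d² ≤ n and l = d + 1, so that n ≤ c·l². Sorting the vertices of G by
-- their layer modulo l, some residue class i holds at most n / l of them. Deleting the layers
-- ≡ i (mod l) cuts the path into blocks of d consecutive layers, so each remaining vertex
-- (h, layer, colour) can go to (h in the copy of H for its block, (position in block, colour)) in
-- (disjoint copies of H) ⊠ K_{d·c}. The deleted vertices all go to one new apex adjacent to every
-- copy, told apart by their rank in the K coordinate. Adding such an apex raises tree-width by at
-- most one: hang copies of a decomposition of H from a new root node and put the apex in every bag.
-- Finally m = max(d·c, n / l) has m² ≤ c·n, since (d·c)² ≤ c·(c·d²) and (n / l)² ≤ n·n / l² ≤ c·n.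

module Submission where

open import Defs
open import Data.Nat using (ℕ; zero; suc; _+_; _*_; _∸_; _≤_; _<_; _⊔_; z≤n; s≤s; s≤s⁻¹; s<s⁻¹; NonZero; _≟_; _≤?_)
open import Data.Nat.Properties
open import Data.Nat.DivMod
open import Data.Nat.Divisibility using (n∣m*n)
open import Data.Nat.Tactic.RingSolver using (solve-∀)
open import Algebra.Properties.CommutativeSemigroup +-commutativeSemigroup using (interchange)
open import Data.Fin using (Fin; toℕ; fromℕ<; inject≤; combine) renaming (zero to fzero; suc to fsuc)
open import Data.Fin.Properties
  using (+↔⊎; *↔×; 1↔⊤; ¬Fin0; toℕ-injective; toℕ<n; toℕ-fromℕ<; fromℕ<-injective; fromℕ<-cong; inject≤-injective;
         combine-injectiveˡ; combine-injectiveʳ)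
import Data.Fin.Properties as Fin
open import Data.Product using (Σ; ∃; ∃-syntax; _×_; _,_; proj₁; proj₂)
open import Data.Product.Properties using (,-injectiveˡ; ,-injectiveʳ)
open import Data.Sum using (_⊎_; inj₁; inj₂)
open import Data.Sum.Properties using (inj₁-injective)
open import Data.Empty using (⊥; ⊥-elim)
open import Data.Unit using (⊤; tt)
open import Data.List using (List; []; _∷_; [_]; length; map; _++_)
open import Data.List.Properties using (length-map)
open import Data.List.Membership.Propositional using (_∈_; _∉_)
open import Data.List.Membership.Propositional.Properties using (∈-map⁺; ∈-map⁻; ∈-∃++)
open import Data.List.Relation.Unary.Any using (here; there; any?)
open import Data.List.Relation.Unary.AllPairs using (_∷_)
open import Data.List.Relation.Unary.Unique.Propositional using (Unique)
open import Data.List.Relation.Unary.Unique.Propositional.Properties using (map⁻; Unique[x∷xs]⇒x∉xs)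
open import Data.List.Relation.Binary.Permutation.Propositional using (_↭_; ↭⇒↭ₛ)
open import Data.List.Relation.Binary.Permutation.Propositional.Properties using (++-comm; ↭-length)
open import Data.List.Relation.Binary.Permutation.Setoid.Properties using (Unique-resp-↭)
open import Relation.Nullary using (¬_; Dec; yes; no)
open import Relation.Binary.PropositionalEquality
  using (_≡_; _≢_; refl; sym; trans; cong; cong₂; subst; setoid; module ≡-Reasoning)
open import Function using (_∘_; Inverse; Injection)
open import Function.Properties.Inverse using (↔-trans; ↔-refl; ↔-sym; ↔⇒↣)
open import Data.Product.Function.NonDependent.Propositional using (_×-↔_)
open import Data.Sum.Function.Propositional using (_⊎-↔_)

Close : (A : Graph) → V A → V A → Set
Close A x y = x ≡ y ⊎ E A x y

⊠-close : ∀ {A B} {p q : V A × V B} → E (A ⊠ B) p q →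
          Close A (proj₁ p) (proj₁ q) × Close B (proj₂ p) (proj₂ q)
⊠-close (sameA e)   = inj₁ refl , inj₂ e
⊠-close (sameB e)   = inj₂ e , inj₁ refl
⊠-close (both e e′) = inj₂ e , inj₂ e′

Close-⊠ : ∀ {A B} {p q : V A × V B} → Close (A ⊠ B) p q →
          Close A (proj₁ p) (proj₁ q) × Close B (proj₂ p) (proj₂ q)
Close-⊠ (inj₁ refl) = inj₁ refl , inj₁ refl
Close-⊠ (inj₂ e)    = ⊠-close e

⊠K-edge : ∀ {A m} {p q : V A × Fin m} → p ≢ q → Close A (proj₁ p) (proj₁ q) → E (A ⊠ K m) p q
⊠K-edge p≢q (inj₁ refl) = sameA (kedge (p≢q ∘ cong (_ ,_)))
⊠K-edge {p = _ , x} {_ , y} p≢q (inj₂ e) with x Fin.≟ y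
... | yes refl = sameB e
... | no x≢y   = both e (kedge x≢y)

ConeV : Graph → ℕ → Set
ConeV A B = (V A × Fin B) ⊎ ⊤

pattern apex = inj₂ tt
pattern _at_ a b = inj₁ (a , b)

data ConeEdge (A : Graph) (B : ℕ) (R : V A → Set) : ConeV A B → ConeV A B → Set where
  copy     : ∀ {a a′ b} → E A a a′ → ConeEdge A B R (a at b) (a′ at b)
  toApex   : ∀ {a b} → R a → ConeEdge A B R (a at b) apex
  fromApex : ∀ {a b} → R a → ConeEdge A B R apex (a at b)

Cone : (A : Graph) (B : ℕ) (R : V A → Set) → Graph
Cone A B R = record
  { V       = ConeV A B
  ; size    = size A * B + 1
  ; enum    = ↔-trans +↔⊎ (↔-trans *↔× (enum A ×-↔ ↔-refl) ⊎-↔ 1↔⊤)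
  ; E       = ConeEdge A B R
  ; Esym    = λ { (copy e) → copy (Esym A e) ; (toApex r) → fromApex r ; (fromApex r) → toApex r }
  ; Eirrefl = λ { (copy e) → Eirrefl A e }
  }

Close-copy : ∀ {A B R a a′ b} → Close A a a′ → Close (Cone A B R) (a at b) (a′ at b)
Close-copy (inj₁ refl) = inj₁ refl
Close-copy (inj₂ e)    = inj₂ (copy e)

apex≟ : ∀ {A B} (v : ConeV A B) → Dec (apex ≡ v)
apex≟ (_ at _) = no λ ()
apex≟ apex     = yes refl

walk-++ : ∀ {G P x y z} → Walk G P x y → Walk G P y z → Walk G P x z
walk-++ (here _)     w′ = w′
walk-++ (step p e w) w′ = step p e (walk-++ w w′)

walk-map : ∀ {G} {P Q : V G → Set} → (∀ {x} → P x → Q x) → ∀ {x y} → Walk G P x y → Walk G Q x y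
walk-map f (here p)     = here (f p)
walk-map f (step p e w) = step (f p) e (walk-map f w)

walk-copy : ∀ {A B R} {P : V A → Set} {Q : ConeV A B → Set} b → (∀ {a} → P a → Q (a at b)) →
            ∀ {x y} → Walk A P x y → Walk (Cone A B R) Q (x at b) (y at b)
walk-copy b f (here p)     = here (f p)
walk-copy b f (step p e w) = step (f p) (copy e) (walk-copy b f w)

path-++ : ∀ {G x vs y ws z} → PathFrom G x vs y → PathFrom G y ws z → PathFrom G x (vs ++ ws) z
path-++ end        q = q
path-++ (cons e p) q = cons e (path-++ p q)

path-split : ∀ {G} ys {x w zs z} → PathFrom G x (ys ++ w ∷ zs) z →
             ∃[ u ] (PathFrom G x ys u × E G u w × PathFrom G w zs z)
path-split []       (cons e p) = _ , end , e , p
path-split (y ∷ ys) (cons e p) with u , p₁ , e₁ , p₂ ← path-split ys p = u , cons e p₁ , e₁ , p₂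

path-last∈ : ∀ {G x y vs z} → PathFrom G x (y ∷ vs) z → z ∈ y ∷ vs
path-last∈ (cons _ end)          = here refl
path-last∈ (cons _ p@(cons _ _)) = there (path-last∈ p)

Cycle-rotate : ∀ {G} (C : Cycle G) {v} → v ∈ Cycle.rest C → Σ (Cycle G) λ C′ → Cycle.start C′ ≡ v
Cycle-rotate record { start = s ; long = long ; walk = p ; close = e ; distinct = u } {v} v∈rest
  with ys , zs , refl ← ∈-∃++ v∈rest
  with w , p₁ , e₁ , p₂ ← path-split ys p
  = record
      { rest     = zs ++ s ∷ ys
      ; long     = subst (2 ≤_) (suc-injective (↭-length swap)) long
      ; walk     = path-++ p₂ (cons e p₁)
      ; close    = e₁
      ; distinct = Unique-resp-↭ (setoid _) (↭⇒↭ₛ swap) u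
      } , refl
  where
    swap : s ∷ ys ++ v ∷ zs ↭ v ∷ zs ++ s ∷ ys
    swap = ++-comm (s ∷ ys) (v ∷ zs)

module _ {A : Graph} {B : ℕ} {R : V A → Set} where

  path-in-copy : ∀ {a b vs z} → apex ∉ vs → PathFrom (Cone A B R) (a at b) vs z →
                 ∃[ as ] ∃[ a′ ] (vs ≡ map (_at b) as × z ≡ a′ at b × PathFrom A a as a′)
  path-in-copy apex∉ end = [] , _ , refl , refl , end
  path-in-copy apex∉ (cons (copy e) p)
    with as , a′ , refl , refl , q ← path-in-copy (apex∉ ∘ there) p
    = _ ∷ as , a′ , refl , refl , cons e q
  path-in-copy apex∉ (cons (toApex _) _) = ⊥-elim (apex∉ (here refl))

module _ {T : Graph} {B : ℕ} {t₀ : V T} where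

  private
    T′ : Graph
    T′ = Cone T B (_≡ t₀)

  Cone-connected : Connected T → Connected T′
  Cone-connected conn x y = walk-++ (to-apex x) (from-apex y)
    where
      to-apex : ∀ x → Walk T′ _ x apex
      to-apex (t at b) = walk-++ (walk-copy b _ (conn t t₀)) (step tt (toApex refl) (here tt))
      to-apex apex     = here tt

      from-apex : ∀ y → Walk T′ _ apex y
      from-apex (t at b) = step tt (fromApex refl) (walk-copy b _ (conn t₀ t))
      from-apex apex     = here tt

  -- Both cycle neighbours of the apex are copies of t₀, and the path between them avoids the apex,
  -- so it stays in one copy: the two neighbours coincide.
  cycle-start≢apex : (C : Cycle T′) → Cycle.start C ≢ apex
  cycle-start≢apex record { rest = [] ; long = () } refl
  cycle-start≢apex record { rest = _ ∷ [] ; long = s≤s () } refl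
  cycle-start≢apex record { rest = (a at b) ∷ y ∷ ys ; walk = cons (fromApex a≡t₀) p
                          ; close = toApex z≡t₀ ; distinct = u@(_ ∷ u′) } refl
    with _ , _ , _ , refl , _ ← path-in-copy (Unique[x∷xs]⇒x∉xs u ∘ there) p
    = Unique[x∷xs]⇒x∉xs u′ (subst (_∈ y ∷ ys) (cong (_at b) (trans z≡t₀ (sym a≡t₀))) (path-last∈ p))

  cycle-avoiding-apex : ¬ Cycle T → (C : Cycle T′) → apex ∉ Cycle.start C ∷ Cycle.rest C → ⊥
  cycle-avoiding-apex noCycle record { start = apex } apex∉ = apex∉ (here refl)
  cycle-avoiding-apex noCycle record { start = s at b ; long = long ; walk = p ; close = e ; distinct = u } apex∉
    with ts , _ , refl , refl , q ← path-in-copy (apex∉ ∘ there) p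
    with copy e′ ← e
    = noCycle record
        { rest     = ts
        ; long     = subst (2 ≤_) (length-map _ ts) long
        ; walk     = q
        ; close    = e′
        ; distinct = map⁻ u
        }

  Cone-acyclic : ¬ Cycle T → ¬ Cycle T′
  Cone-acyclic noCycle C with any? (apex≟ {T} {B}) (Cycle.start C ∷ Cycle.rest C)
  ... | yes (here start≡apex) = cycle-start≢apex C (sym start≡apex)
  ... | yes (there apex∈rest) with C′ , refl ← Cycle-rotate C apex∈rest = cycle-start≢apex C′ refl
  ... | no apex∉              = cycle-avoiding-apex noCycle C apex∉

Cone-isTree : ∀ {T} B (tree : IsTree T) → IsTree (Cone T B (_≡ proj₁ tree))
Cone-isTree B (t₀ , conn , noCycle) = apex , Cone-connected conn , Cone-acyclic noCycle

module _ {H : Graph} (B : ℕ) (D : TreeDecomposition H) where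

  private
    L T′ : Graph
    L  = Cone H B (λ _ → ⊤)
    T′ = Cone (T D) B (_≡ proj₁ (isTree D))

  coneBag : V T′ → List (V L)
  coneBag (t at b) = apex ∷ map (_at b) (bag D t)
  coneBag apex     = [ apex ]

  apex∈coneBag : ∀ s → apex ∈ coneBag s
  apex∈coneBag (_ at _) = here refl
  apex∈coneBag apex     = here refl

  ∈-coneBag : ∀ {h b s} → h at b ∈ coneBag s → ∃[ t ] (s ≡ t at b × h ∈ bag D t)
  ∈-coneBag {s = t at _} (there h∈) with _ , h∈′ , refl ← ∈-map⁻ _ h∈ = t , refl , h∈′
  ∈-coneBag {s = apex} (here ())

  copy∈coneBag : ∀ {h t} b → h ∈ bag D t → h at b ∈ coneBag (t at b)
  copy∈coneBag b = there ∘ ∈-map⁺ (_at b)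

  Cone-decomposition : TreeDecomposition L
  Cone-decomposition = record
    { T       = T′
    ; isTree  = Cone-isTree B (isTree D)
    ; bag     = coneBag
    ; vcover  = vcover′
    ; ecover  = ecover′
    ; subtree = subtree′
    }
    where
      vcover′ : ∀ v → ∃[ t ] v ∈ coneBag t
      vcover′ (h at b) with t , h∈ ← vcover D h = t at b , copy∈coneBag b h∈
      vcover′ apex     = apex , here refl

      ecover′ : ∀ {v w} → E L v w → ∃[ t ] (v ∈ coneBag t × w ∈ coneBag t)
      ecover′ (copy {b = b} e) with t , v∈ , w∈ ← ecover D e = t at b , copy∈coneBag b v∈ , copy∈coneBag b w∈
      ecover′ (toApex {a} {b} _) with t , a∈ ← vcover D a = t at b , copy∈coneBag b a∈ , here refl
      ecover′ (fromApex {a} {b} _) with t , a∈ ← vcover D a = t at b , here refl , copy∈coneBag b a∈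

      subtree′ : ∀ v s t → v ∈ coneBag s → v ∈ coneBag t → Walk T′ (λ u → v ∈ coneBag u) s t
      subtree′ apex s t _ _ = walk-map (λ {u} _ → apex∈coneBag u) (Cone-connected (proj₁ (proj₂ (isTree D))) s t)
      subtree′ (h at b) s t h∈s h∈t
        with s′ , refl , h∈s′ ← ∈-coneBag h∈s
        with t′ , refl , h∈t′ ← ∈-coneBag h∈t
        = walk-copy b (copy∈coneBag b) (subtree D h s′ t′ h∈s′ h∈t′)

  coneBag-length : ∀ {k} → (∀ t → length (bag D t) ≤ k) → ∀ t → length (coneBag t) ≤ suc k
  coneBag-length width (t at b) = s≤s (≤-trans (≤-reflexive (length-map _ (bag D t))) (width t))
  coneBag-length width apex     = s≤s z≤n

Cone-tw≤tw+1 : ∀ H B → TwLeTwPlusOne (Cone H B (λ _ → ⊤)) H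
Cone-tw≤tw+1 H B k (D , width) = Cone-decomposition B D , coneBag-length B D width

indicator : ℕ → ℕ → ℕ
indicator a i with a ≟ i
... | yes _ = 1
... | no  _ = 0

indicator-≡ : ∀ {a i} → a ≡ i → indicator a i ≡ 1
indicator-≡ {a} {i} a≡i with a ≟ i
... | yes _   = refl
... | no  a≢i = ⊥-elim (a≢i a≡i)

indicator-≢ : ∀ {a i} → a ≢ i → indicator a i ≡ 0
indicator-≢ {a} {i} a≢i with a ≟ i
... | yes a≡i = ⊥-elim (a≢i a≡i)
... | no  _   = refl

count : ∀ n → (Fin n → ℕ) → ℕ → ℕ
count zero    g i = 0
count (suc n) g i = indicator (g fzero) i + count n (g ∘ fsuc) i

rank : ∀ n → (Fin n → ℕ) → ℕ → Fin n → ℕ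
rank (suc n) g i fzero    = 0
rank (suc n) g i (fsuc j) = indicator (g fzero) i + rank n (g ∘ fsuc) i j

rank<count : ∀ n g {i} j → g j ≡ i → rank n g i j < count n g i
rank<count (suc n) g fzero    gj≡i rewrite indicator-≡ gj≡i = s≤s z≤n
rank<count (suc n) g (fsuc j) gj≡i = +-monoʳ-< (indicator (g fzero) _) (rank<count n (g ∘ fsuc) j gj≡i)

rank-injective : ∀ n g {i} j j′ → g j ≡ i → g j′ ≡ i → rank n g i j ≡ rank n g i j′ → j ≡ j′
rank-injective (suc n) g fzero    fzero     _    _     _ = refl
rank-injective (suc n) g fzero    (fsuc j′) gj≡i _     eq rewrite indicator-≡ gj≡i with () ← eq
rank-injective (suc n) g (fsuc j) fzero     _    gj′≡i eq rewrite indicator-≡ gj′≡i with () ← eq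
rank-injective (suc n) g (fsuc j) (fsuc j′) gj≡i gj′≡i eq =
  cong fsuc (rank-injective n (g ∘ fsuc) j j′ gj≡i gj′≡i (+-cancelˡ-≡ (indicator (g fzero) _) _ _ eq))

sumBelow : ℕ → (ℕ → ℕ) → ℕ
sumBelow zero    h = 0
sumBelow (suc l) h = h l + sumBelow l h

sumBelow-+ : ∀ l h₁ h₂ → sumBelow l (λ i → h₁ i + h₂ i) ≡ sumBelow l h₁ + sumBelow l h₂
sumBelow-+ zero    h₁ h₂ = refl
sumBelow-+ (suc l) h₁ h₂ rewrite sumBelow-+ l h₁ h₂ = interchange (h₁ l) (h₂ l) (sumBelow l h₁) (sumBelow l h₂)

sumBelow-indicator : ∀ l {a} → a < l → sumBelow l (indicator a) ≡ 1
sumBelow-indicator (suc l) {a} a<1+l with a ≟ l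
... | yes refl = cong suc (vanish l ≤-refl)
  where
    vanish : ∀ k → k ≤ a → sumBelow k (indicator a) ≡ 0
    vanish zero    _   = refl
    vanish (suc k) k<a rewrite indicator-≢ (>⇒≢ k<a) = vanish k (<⇒≤ k<a)
... | no a≢l   = sumBelow-indicator l (≤∧≢⇒< (s≤s⁻¹ a<1+l) a≢l)

sumBelow-count : ∀ l n g → (∀ j → g j < l) → sumBelow l (count n g) ≡ n
sumBelow-count l zero    g _     = sumBelow-zero l
  where
    sumBelow-zero : ∀ l → sumBelow l (λ _ → 0) ≡ 0
    sumBelow-zero zero    = refl
    sumBelow-zero (suc l) = sumBelow-zero l
sumBelow-count l (suc n) g g<l = begin
  sumBelow l (λ i → indicator (g fzero) i + count n (g ∘ fsuc) i)    ≡⟨ sumBelow-+ l _ _ ⟩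
  sumBelow l (indicator (g fzero)) + sumBelow l (count n (g ∘ fsuc)) ≡⟨ cong₂ _+_ (sumBelow-indicator l (g<l fzero))
                                                                                    (sumBelow-count l n (g ∘ fsuc) (g<l ∘ fsuc)) ⟩
  suc n                                                                 ∎
  where open ≡-Reasoning

averaging : ∀ l h → ∃[ i ] (i < suc l × suc l * h i ≤ sumBelow (suc l) h)
averaging zero    h = 0 , s≤s z≤n , ≤-refl
averaging (suc l) h with i , i<1+l , bound ← averaging l h with h i ≤? h (suc l)
... | yes hi≤hl = i , m<n⇒m<1+n i<1+l , +-mono-≤ hi≤hl bound
... | no  hi≰hl = suc l , ≤-refl , +-monoʳ-≤ (h (suc l)) (≤-trans (*-monoʳ-≤ (suc l) (<⇒≤ (≰⇒> hi≰hl))) bound)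

small-fibre : ∀ l n g → (∀ j → g j < suc l) → ∃[ i ] (i < suc l × suc l * count n g i ≤ n)
small-fibre l n g g<l with i , i<l , bound ← averaging l (count n g) =
  i , i<l , subst (suc l * count n g i ≤_) (sumBelow-count (suc l) n g g<l) bound

bracket : ∀ (f : ℕ → ℕ) {n} k → f 0 ≤ n → n ≤ f (suc k) → ∃[ d ] (f d ≤ n × n ≤ f (suc d))
bracket f zero    f0≤n n≤f1 = 0 , f0≤n , n≤f1
bracket f {n} (suc k) f0≤n n≤f[2+k] with n ≤? f (suc k)
... | yes n≤f[1+k] = bracket f k f0≤n n≤f[1+k]
... | no  n≰f[1+k] = suc k , <⇒≤ (≰⇒> n≰f[1+k]) , n≤f[2+k]

n≤c*[1+n]² : ∀ n c → (Fin n → Fin c) → n ≤ c * suc n * suc n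
n≤c*[1+n]² zero    c       _ = z≤n
n≤c*[1+n]² (suc n) zero    g = ⊥-elim (¬Fin0 (g fzero))
n≤c*[1+n]² (suc n) (suc c) _ = ≤-trans (n≤1+n (suc n)) (≤-trans (m≤n*m (suc (suc n)) (suc c)) (m≤m*n _ (suc (suc n))))

divMod-injective : ∀ m o n .{{_ : NonZero n}} → m % n ≡ o % n → m / n ≡ o / n → m ≡ o
divMod-injective m o n r≡ q≡ = begin
  m                  ≡⟨ m≡m%n+[m/n]*n m n ⟩
  m % n + m / n * n  ≡⟨ cong₂ (λ r q → r + q * n) r≡ q≡ ⟩
  o % n + o / n * n  ≡⟨ m≡m%n+[m/n]*n o n ⟨
  o                  ∎
  where open ≡-Reasoning

[m+[n∸i]]%n≡0⇒m%n≡i : ∀ m n {i} .{{_ : NonZero n}} → i < n → (m + (n ∸ i)) % n ≡ 0 → m % n ≡ i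
[m+[n∸i]]%n≡0⇒m%n≡i m n {i} i<n ≡0 = begin
  m % n                             ≡⟨ [m+n]%n≡m%n m n ⟨
  (m + n) % n                       ≡⟨ cong (λ k → (m + k) % n) (m∸n+n≡m (<⇒≤ i<n)) ⟨
  (m + (n ∸ i + i)) % n             ≡⟨ cong (_% n) (+-assoc m (n ∸ i) i) ⟨
  (m + (n ∸ i) + i) % n             ≡⟨ %-distribˡ-+ (m + (n ∸ i)) i n ⟩
  ((m + (n ∸ i)) % n + i % n) % n   ≡⟨ cong (λ r → (r + i % n) % n) ≡0 ⟩
  i % n % n                         ≡⟨ m%n%n≡m%n i n ⟩
  i % n                             ≡⟨ m<n⇒m%n≡m i<n ⟩
  i                                 ∎
  where open ≡-Reasoning

[1+m]%n≢0⇒[1+m]/n≡m/n : ∀ m n .{{_ : NonZero n}} → suc m % n ≢ 0 → suc m / n ≡ m / n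
[1+m]%n≢0⇒[1+m]/n≡m/n m n ≢0 = begin
  suc m / n                        ≡⟨ cong (_/ n) split ⟩
  (suc (m % n) + m / n * n) / n    ≡⟨ +-distrib-/-∣ʳ (suc (m % n)) (n∣m*n (m / n)) ⟩
  suc (m % n) / n + m / n * n / n  ≡⟨ cong₂ _+_ (m<n⇒m/n≡0 1+r<n) (m*n/n≡m (m / n) n) ⟩
  m / n                            ∎
  where
    open ≡-Reasoning
    split : suc m ≡ suc (m % n) + m / n * n
    split = cong suc (m≡m%n+[m/n]*n m n)
    1+r≢n : suc (m % n) ≢ n
    1+r≢n 1+r≡n = ≢0 (begin
      suc m % n                      ≡⟨ cong (_% n) split ⟩
      (suc (m % n) + m / n * n) % n  ≡⟨ [m+kn]%n≡m%n (suc (m % n)) (m / n) n ⟩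
      suc (m % n) % n                ≡⟨ cong (_% n) 1+r≡n ⟩
      n % n                          ≡⟨ n%n≡0 n ⟩
      0                              ∎)
    1+r<n : suc (m % n) < n
    1+r<n = ≤∧≢⇒< (m%n<n m n) 1+r≢n

⊔-square≤ : ∀ a b {N} → a * a ≤ N → b * b ≤ N → (a ⊔ b) * (a ⊔ b) ≤ N
⊔-square≤ a b a²≤N b²≤N with ⊔-sel a b
... | inj₁ a⊔b≡a rewrite a⊔b≡a = a²≤N
... | inj₂ a⊔b≡b rewrite a⊔b≡b = b²≤N

[d*c]²≤c*n : ∀ c d n → c * d * d ≤ n → (d * c) * (d * c) ≤ c * n
[d*c]²≤c*n c d n cd²≤n = begin
  (d * c) * (d * c)  ≡⟨ rearrange c d ⟩
  c * (c * d * d)    ≤⟨ *-monoʳ-≤ c cd²≤n ⟩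
  c * n              ∎
  where
    open ≤-Reasoning
    rearrange : ∀ c d → (d * c) * (d * c) ≡ c * (c * d * d)
    rearrange = solve-∀

x²≤c*n : ∀ c l x n .{{_ : NonZero l}} → l * x ≤ n → n ≤ c * l * l → x * x ≤ c * n
x²≤c*n c l x n lx≤n n≤cl² = *-cancelʳ-≤ (x * x) (c * n) (l * l) {{m*n≢0 l l}} (begin
  x * x * (l * l)    ≡⟨ rearrange₁ x l ⟩
  (l * x) * (l * x)  ≤⟨ *-mono-≤ lx≤n lx≤n ⟩
  n * n              ≤⟨ *-monoʳ-≤ n n≤cl² ⟩
  n * (c * l * l)    ≡⟨ rearrange₂ n c l ⟩
  c * n * (l * l)    ∎)
  where
    open ≤-Reasoning
    rearrange₁ : ∀ x l → x * x * (l * l) ≡ (l * x) * (l * x)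
    rearrange₁ = solve-∀
    rearrange₂ : ∀ n c l → n * (c * l * l) ≡ c * n * (l * l)
    rearrange₂ = solve-∀

module Embedding (H : Graph) (p c : ℕ) (G : Graph) (G↪ : G ⊆G (H ⊠ PathG p ⊠ K c)) where

  n : ℕ
  n = ∣ G ∣ᵥ

  vertex : Fin n → V G
  vertex = Inverse.to (enum G)

  index : V G → Fin n
  index = Inverse.from (enum G)

  vertex-index : ∀ v → vertex (index v) ≡ v
  vertex-index = Inverse.strictlyInverseˡ (enum G)

  index-injective : ∀ {u v} → index u ≡ index v → u ≡ v
  index-injective = Injection.injective (↔⇒↣ (↔-sym (enum G)))

  f : V G → (V H × Fin p) × Fin c
  f = proj₁ G↪

  h : V G → V H
  h v = proj₁ (proj₁ (f v))

  layer : V G → Fin p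
  layer v = proj₂ (proj₁ (f v))

  colour : V G → Fin c
  colour v = proj₂ (f v)

  f-injective : ∀ {u v} → h u ≡ h v → layer u ≡ layer v → colour u ≡ colour v → u ≡ v
  f-injective h≡ layer≡ colour≡ = proj₁ (proj₂ G↪) (cong₂ _,_ (cong₂ _,_ h≡ layer≡) colour≡)

  E⇒Close : ∀ {u v} → E G u v → Close H (h u) (h v) × Close (PathG p) (layer u) (layer v)
  E⇒Close e = Close-⊠ (proj₁ (⊠-close (proj₂ (proj₂ G↪) e)))

  d-bounds : ∃[ d ] (c * d * d ≤ n × n ≤ c * suc d * suc d)
  d-bounds = bracket (λ d → c * d * d) n (≤-trans (≤-reflexive (*-zeroʳ (c * 0))) z≤n)
                     (n≤c*[1+n]² n c (colour ∘ vertex))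

  d l : ℕ
  d = proj₁ d-bounds
  l = suc d

  c*d*d≤n : c * d * d ≤ n
  c*d*d≤n = proj₁ (proj₂ d-bounds)

  n≤c*l*l : n ≤ c * l * l
  n≤c*l*l = proj₂ (proj₂ d-bounds)

  residue : Fin n → ℕ
  residue j = toℕ (layer (vertex j)) % l

  sparse-residue : ∃[ i ] (i < l × l * count n residue i ≤ n)
  sparse-residue = small-fibre d n residue (λ j → m%n<n (toℕ (layer (vertex j))) l)

  i x m B : ℕ
  i = proj₁ sparse-residue
  x = count n residue i
  m = d * c ⊔ x
  B = p + l  -- any bound on the number of blocks will do

  i<l : i < l
  i<l = proj₁ (proj₂ sparse-residue)

  l*x≤n : l * x ≤ n
  l*x≤n = proj₂ (proj₂ sparse-residue)

  L : Graph
  L = Cone H B (λ _ → ⊤)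

  -- Shifting by l ∸ i sends the deleted layers to the multiples of l; a kept layer j then lies in
  -- block shift j / l, at position shift j % l ∸ 1 < d.
  shift : Fin p → ℕ
  shift j = toℕ j + (l ∸ i)

  block : V G → Fin B
  block v = fromℕ< (≤-<-trans (m/n≤m (shift (layer v)) l) (+-mono-<-≤ (toℕ<n (layer v)) (m∸n≤m l i)))

  data Kind (v : V G) : Set where
    removed : shift (layer v) % l ≡ 0 → Kind v
    kept    : (q : Fin d) → shift (layer v) % l ≡ suc (toℕ q) → Kind v

  kind : ∀ v → Kind v
  kind v with shift (layer v) % l in r≡
  ... | zero  = removed r≡
  ... | suc r = kept (fromℕ< r<d) (trans r≡ (cong suc (sym (toℕ-fromℕ< r<d))))
    where
      r<d : r < d
      r<d = s<s⁻¹ (subst (_< l) r≡ (m%n<n (shift (layer v)) l))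

  removed-residue : ∀ {v} → shift (layer v) % l ≡ 0 → residue (index v) ≡ i
  removed-residue {v} ≡0 = trans (cong (λ w → toℕ (layer w) % l) (vertex-index v))
                                 ([m+[n∸i]]%n≡0⇒m%n≡i (toℕ (layer v)) l i<l ≡0)

  place : ∀ v → Kind v → V L × Fin m
  place v (removed ≡0) =
    apex , fromℕ< (≤-trans (rank<count n residue (index v) (removed-residue ≡0)) (m≤n⊔m (d * c) x))
  place v (kept q _)   = h v at block v , inject≤ (combine q (colour v)) (m≤m⊔n (d * c) x)

  place-injective : ∀ {u v} (ku : Kind u) (kv : Kind v) → place u ku ≡ place v kv → u ≡ v
  place-injective {u} {v} (removed ≡0) (removed ≡0′) eq =
    index-injective (rank-injective n residue (index u) (index v) (removed-residue ≡0) (removed-residue ≡0′)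
      (fromℕ<-injective _ _ _ _ (,-injectiveʳ eq)))
  place-injective (removed _) (kept _ _)  ()
  place-injective (kept _ _)  (removed _) ()
  place-injective {u} {v} (kept q r≡) (kept q′ r≡′) eq = f-injective h≡ layer≡ colour≡
    where
      code≡ : combine q (colour u) ≡ combine q′ (colour v)
      code≡ = inject≤-injective _ _ _ _ (,-injectiveʳ eq)
      h≡ : h u ≡ h v
      h≡ = ,-injectiveˡ (inj₁-injective (,-injectiveˡ eq))
      colour≡ : colour u ≡ colour v
      colour≡ = combine-injectiveʳ q (colour u) q′ (colour v) code≡
      remainder≡ : shift (layer u) % l ≡ shift (layer v) % l
      remainder≡ = trans r≡ (trans (cong (suc ∘ toℕ) (combine-injectiveˡ q (colour u) q′ (colour v) code≡)) (sym r≡′))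
      quotient≡ : shift (layer u) / l ≡ shift (layer v) / l
      quotient≡ = fromℕ<-injective _ _ _ _ (,-injectiveʳ (inj₁-injective (,-injectiveˡ eq)))
      layer≡ : layer u ≡ layer v
      layer≡ = toℕ-injective (+-cancelʳ-≡ (l ∸ i) _ _ (divMod-injective _ _ l remainder≡ quotient≡))

  quotient-suc : ∀ {j j′} → toℕ j′ ≡ suc (toℕ j) → shift j′ % l ≢ 0 → shift j′ / l ≡ shift j / l
  quotient-suc {j} {j′} j′≡1+j ≢0 =
    trans (cong (_/ l) shift≡) ([1+m]%n≢0⇒[1+m]/n≡m/n (shift j) l (subst (λ k → k % l ≢ 0) shift≡ ≢0))
    where
      shift≡ : shift j′ ≡ suc (shift j)
      shift≡ = cong (_+ (l ∸ i)) j′≡1+j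

  quotient-cong : ∀ {j j′} → Close (PathG p) j j′ → shift j % l ≢ 0 → shift j′ % l ≢ 0 → shift j / l ≡ shift j′ / l
  quotient-cong (inj₁ refl)         _  _   = refl
  quotient-cong (inj₂ (fwd j′≡1+j)) _  ≢0′ = sym (quotient-suc j′≡1+j ≢0′)
  quotient-cong (inj₂ (bwd j≡1+j′)) ≢0 _   = quotient-suc j≡1+j′ ≢0

  same-block : ∀ {u v r r′} → Close (PathG p) (layer u) (layer v) →
               shift (layer u) % l ≡ suc r → shift (layer v) % l ≡ suc r′ → block u ≡ block v
  same-block close r≡ r≡′ = fromℕ<-cong _ _ (quotient-cong close (1+n≢0 ∘ trans (sym r≡)) (1+n≢0 ∘ trans (sym r≡′))) _ _

  place-close : ∀ {u v} → E G u v → (ku : Kind u) (kv : Kind v) →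
                Close L (proj₁ (place u ku)) (proj₁ (place v kv))
  place-close e (removed _) (removed _) = inj₁ refl
  place-close e (removed _) (kept _ _)  = inj₂ (fromApex tt)
  place-close e (kept _ _)  (removed _) = inj₂ (toApex tt)
  place-close {u} {v} e (kept _ r≡) (kept _ r≡′) =
    subst (λ b → Close L (h u at block u) (h v at b)) (same-block (proj₂ (E⇒Close e)) r≡ r≡′)
          (Close-copy (proj₁ (E⇒Close e)))

  embedding : G ⊆G (L ⊠ K m)
  embedding = F , (λ {u} {v} → place-injective (kind u) (kind v)) , F-edge
    where
      F : V G → V L × Fin m
      F v = place v (kind v)
      F-edge : ∀ {u v} → E G u v → E (L ⊠ K m) (F u) (F v)
      F-edge {u} {v} e = ⊠K-edge (λ F≡ → Eirrefl G (subst (E G u) (sym (place-injective (kind u) (kind v) F≡)) e))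
                                 (place-close e (kind u) (kind v))

  m²≤c*n : m * m ≤ c * n
  m²≤c*n = ⊔-square≤ (d * c) x ([d*c]²≤c*n c d n c*d*d≤n) (x²≤c*n c l x n l*x≤n n≤c*l*l)

lemma31 : (H : Graph) (p c : ℕ) (G : Graph) →
    G ⊆G (H ⊠ PathG p ⊠ K c) →
    Σ Graph λ L → Σ ℕ λ m →
      TwLeTwPlusOne L H × (m * m ≤ c * ∣ G ∣ᵥ) × (G ⊆G (L ⊠ K m))
lemma31 H p c G G↪ = L , m , Cone-tw≤tw+1 H B , m²≤c*n , embedding
  where open Embedding H p c G G↪
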